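{- Let $n\geq 1$. Consider the arrangement of the lines $\mathcal{L}_0,\dots,\mathcal{L}_{n-1}$ and the arrangement of the lines $\mathcal{L}_0,\dots,\mathcal{L}_{n-2}$ (for $n=1$ the latter is the empty arrangement, whose only region is the whole plane, with code the empty word $\varepsilon$). Adding the line $\mathcal{L}_{n-1}$ creates exactly $n$ new regions, namely the regions of the first arrangement contained in $\mathcal{H}_{n-1}^-$, and their codes are $1^k0^{n-k}$ for $k=0,1,\dots,n-1$. The remaining regions of the first arrangement correspond to the regions of the second arrangement, the code of each being obtained from the code $w$ of the corresponding old region by appending the digit $1$, i.e. it is $w1$. Consequently, $\mathcal{P}_n=\{w1: w\in\mathcal{P}_{n-1}\}\cup\{1^k0^{n-k}: 0\leq k\leq n-1\}$.
   Context: For a nonnegative integer $m$, $\mathcal{L}_m$ is the line $y=mx-m^2$ in $\mathbb{R}^2$, $H_m(x,y)=y-mx+m^2$, $\mathcal{H}_m^+=\{H_m>0\}$ and $\mathcal{H}_m^-=\{H_m<0\}$. A region of the arrangement of $\mathcal{L}_0,\dots,\mathcal{L}_{n-1}$ is a connected component of the complement of the union of these lines. Its code is the binary word $\sigma_0\sigma_1\cdots\sigma_{n-1}$ where $\sigma_i=0$ if the region lies in $\mathcal{H}_i^-$ and $\sigma_i=1$ if it lies in $\mathcal{H}_i^+$. $\mathcal{P}_n$ denotes the set of codes of the regions of this arrangement; $\mathcal{P}_0=\{\varepsilon\}$. For a digit $\sigma$ and integer $k$, $\sigma^k$ is the word of $k$ copies of $\sigma$ (empty if $k\leq 0$), and juxtaposition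 denotes concatenation.
   Formalization: The lines, their regions and the points witnessing each code are taken in the rational plane ℚ² instead of ℝ². -}

module Defs where

open import Data.Nat using (ℕ; zero; suc)
open import Data.Integer using (+_)
open import Data.Rational using (ℚ; _/_; _+_; _-_; _*_; _<_; 0ℚ)
open import Data.Bool using (Bool; true; false)
open import Data.Fin using (Fin; toℕ)
open import Data.Vec using (Vec; []; _∷_; lookup; replicate)
open import Data.Product using (Σ; _×_)

-- Digits: false = 0, true = 1.  A word of length n is a Vec Bool n.

ℕ→ℚ : ℕ → ℚ
ℕ→ℚ m = (+ m) / 1

H : ℕ → ℚ → ℚ → ℚ
H m x y = (y - ℕ→ℚ m * x) + ℕ→ℚ m * ℕ→ℚ m

-- the point (x,y) lies in the half-plane H_m^+ (if σ = 1) resp. H_m^- (if σ = 0)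
InHalf : Bool → ℕ → ℚ → ℚ → Set
InHalf true  m x y = 0ℚ < H m x y
InHalf false m x y = H m x y < 0ℚ

HasCode : (n : ℕ) → Vec Bool n → ℚ → ℚ → Set
HasCode n σ x y = (i : Fin n) → InHalf (lookup σ i) (toℕ i) x y

-- σ ∈ P_n : σ is the code of a region of the arrangement L_0,…,L_{n-1},
-- i.e. the open cell ⋂_i H_i^{σ_i} is nonempty (witnessed by a point).
InP : (n : ℕ) → Vec Bool n → Set
InP n σ = Σ ℚ λ x → Σ ℚ λ y → HasCode n σ x y

block : (n k : ℕ) → Vec Bool n
block zero    k       = []
block (suc n) zero    = replicate (suc n) false
block (suc n) (suc k) = true ∷ block n k

-- At a fixed point (x, y) the map i ↦ H_i(x, y) = i² - x i + y is convex in i: its forward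
-- difference H_{i+1} - H_i = 2i + 1 - x increases.  Hence it is negative exactly on an interval of
-- indices, and every code has the form 1^a 0^b 1^c.  Conversely the tangents L_u and L_v of
-- the parabola y = x²/4 meet at (u + v, u v), where H_i = (i - u)(i - v); taking u = a - ½
-- and v = a + b - ½ realises 1^a 0^b 1^c.  The proposition thus reduces to two facts about
-- this regular language: w1 belongs to it iff w does, and its words ending in 0 are 1^k 0^(n-k).
module Submission where

open import Defs
open import Data.Nat using (ℕ; suc; _<_)
open import Data.Bool using (Bool; true; false)
open import Data.Vec using (Vec; _∷ʳ_; last)
open import Data.Product using (Σ; _×_)
open import Data.Sum using (_⊎_)
open import Function.Bundles using (_⇔_)
open import Relation.Binary.PropositionalEquality using (_≡_)

open import Data.Nat as ℕ using (zero; _≤_; z≤n; s≤s)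
import Data.Nat.Properties as ℕ
open import Data.Nat.Coprimality as Coprime using (Coprime; 1-coprimeTo)
open import Data.Integer as ℤ using ()
open import Data.Integer.Properties using (+◃n≡+n)
import Data.Sign as Sign
open import Data.Rational as ℚ using (ℚ; mkℚ; 0ℚ; 1ℚ; ½; _+_; _-_; _*_; -_; positive; negative)
open import Data.Rational.Properties as ℚ
  using (normalize-coprime; normalize-nonNeg; nonNegative⁻¹; positive⁻¹; negative⁻¹;
         +-mono-<; +-mono-≤-<; neg-antimono-<; <-asym; pos*pos⇒pos; neg*neg⇒pos; pos*neg⇒neg;
         +-*-commutativeRing)
open import Tactic.RingSolver using (solve-∀)
open import Tactic.RingSolver.Core.AlmostCommutativeRing using (AlmostCommutativeRing; fromCommutativeRing)
open import Level using (0ℓ)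
open import Relation.Nullary.Decidable using (dec⇒maybe)
open import Data.Fin using (toℕ; zero; suc)
open import Data.Vec using ([]; _∷_; lookup; replicate; initLast)
open import Data.Vec.Properties using (last-∷ʳ)
open import Data.Product using (_,_; proj₁; ∃-syntax)
open import Data.Product.Function.NonDependent.Propositional using (_×-⇔_)
open import Data.Sum using (inj₁; inj₂)
open import Data.Unit using (⊤; tt)
open import Data.Empty using (⊥)
open import Function using (_∘_)
open import Function.Bundles using (mk⇔; Equivalence)
import Function.Properties.Equivalence as ⇔
open import Relation.Binary.PropositionalEquality using (refl; sym; trans; cong; subst; module ≡-Reasoning)

-- A genuine zero test lets the solver cancel terms such as h - h.
ℚ-ring : AlmostCommutativeRing 0ℓ 0ℓ
ℚ-ring = fromCommutativeRing +-*-commutativeRing (λ q → dec⇒maybe (0ℚ ℚ.≟ q))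

ℕ→ℚ-suc : ∀ m → ℕ→ℚ (suc m) ≡ 1ℚ + ℕ→ℚ m
ℕ→ℚ-suc m = begin
  ℕ→ℚ (suc m)                                ≡⟨ cong (ℕ→ℚ ∘ suc) (ℕ.*-identityʳ m) ⟨
  ℕ→ℚ (suc (m ℕ.* 1))                        ≡⟨ cong (λ i → (ℤ.+ 1 ℤ.+ i) ℚ./ 1) (+◃n≡+n (m ℕ.* 1)) ⟨
  (ℤ.+ 1 ℤ.+ (Sign.+ ℤ.◃ (m ℕ.* 1))) ℚ./ 1   ≡⟨⟩
  1ℚ + mkℚ (ℤ.+ m) 0 coprime                 ≡⟨ cong (λ q → 1ℚ + q) (normalize-coprime coprime) ⟨
  1ℚ + ℕ→ℚ m                                 ∎
  where
  open ≡-Reasoning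
  coprime : Coprime m 1
  coprime = Coprime.sym (1-coprimeTo m)

ℕ→ℚ-+ : ∀ m n → ℕ→ℚ (m ℕ.+ n) ≡ ℕ→ℚ m + ℕ→ℚ n
ℕ→ℚ-+ zero    n = sym (ℚ.+-identityˡ (ℕ→ℚ n))
ℕ→ℚ-+ (suc m) n = begin
  ℕ→ℚ (suc (m ℕ.+ n))          ≡⟨ ℕ→ℚ-suc (m ℕ.+ n) ⟩
  1ℚ + ℕ→ℚ (m ℕ.+ n)           ≡⟨ cong (λ q → 1ℚ + q) (ℕ→ℚ-+ m n) ⟩
  1ℚ + (ℕ→ℚ m + ℕ→ℚ n)         ≡⟨ ℚ.+-assoc 1ℚ (ℕ→ℚ m) (ℕ→ℚ n) ⟨
  1ℚ + ℕ→ℚ m + ℕ→ℚ n           ≡⟨ cong (_+ ℕ→ℚ n) (ℕ→ℚ-suc m) ⟨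
  ℕ→ℚ (suc m) + ℕ→ℚ n          ∎
  where open ≡-Reasoning

ℕ→ℚ-nonNeg : ∀ m → 0ℚ ℚ.≤ ℕ→ℚ m
ℕ→ℚ-nonNeg m = nonNegative⁻¹ (ℕ→ℚ m) {{normalize-nonNeg m 1}}

ΔH : ℕ → ℚ → ℚ
ΔH i x = ℕ→ℚ i + ℕ→ℚ i + 1ℚ - x

H-suc : ∀ i x y → H (suc i) x y ≡ H i x y + ΔH i x
H-suc i x y rewrite ℕ→ℚ-suc i = identity (ℕ→ℚ i) x y
  where
  identity : ∀ c x y → y - (1ℚ + c) * x + (1ℚ + c) * (1ℚ + c) ≡ y - c * x + c * c + (c + c + 1ℚ - x)
  identity = solve-∀ ℚ-ring

ΔH-suc : ∀ i x → ΔH (suc i) x ≡ ΔH i x + (1ℚ + 1ℚ)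
ΔH-suc i x rewrite ℕ→ℚ-suc i = identity (ℕ→ℚ i) x
  where
  identity : ∀ c x → 1ℚ + c + (1ℚ + c) + 1ℚ - x ≡ c + c + 1ℚ - x + (1ℚ + 1ℚ)
  identity = solve-∀ ℚ-ring

ΔH-pos-suc : ∀ i x → 0ℚ ℚ.< ΔH i x → 0ℚ ℚ.< ΔH (suc i) x
ΔH-pos-suc i x Δ>0 = subst (0ℚ ℚ.<_) (sym (ΔH-suc i x)) (+-mono-< Δ>0 (positive⁻¹ (1ℚ + 1ℚ)))

H-pos-suc : ∀ i x y → 0ℚ ℚ.< H i x y → 0ℚ ℚ.< ΔH i x → 0ℚ ℚ.< H (suc i) x y
H-pos-suc i x y H>0 Δ>0 = subst (0ℚ ℚ.<_) (sym (H-suc i x y)) (+-mono-< H>0 Δ>0)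

ΔH-pos-of-sign-change : ∀ i x y → H i x y ℚ.< 0ℚ → 0ℚ ℚ.< H (suc i) x y → 0ℚ ℚ.< ΔH i x
ΔH-pos-of-sign-change i x y H<0 H′>0 =
  subst (0ℚ ℚ.<_) ΔH≡difference (+-mono-< H′>0 (neg-antimono-< H<0))
  where
  cancel : ∀ h d → h + d - h ≡ d
  cancel = solve-∀ ℚ-ring
  ΔH≡difference : H (suc i) x y - H i x y ≡ ΔH i x
  ΔH≡difference = trans (cong (_- H i x y) (H-suc i x y)) (cancel (H i x y) (ΔH i x))

Ones ZerosOnes OnesZerosOnes : ∀ {n} → Vec Bool n → Set
Ones []          = ⊤
Ones (true ∷ σ)  = Ones σ
Ones (false ∷ σ) = ⊥

ZerosOnes []          = ⊤
ZerosOnes (false ∷ σ) = ZerosOnes σ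
ZerosOnes (true ∷ σ)  = Ones σ

OnesZerosOnes []          = ⊤
OnesZerosOnes (true ∷ σ)  = OnesZerosOnes σ
OnesZerosOnes (false ∷ σ) = ZerosOnes σ

HasCodeFrom : ∀ {n} → ℕ → Vec Bool n → ℚ → ℚ → Set
HasCodeFrom o []      x y = ⊤
HasCodeFrom o (s ∷ σ) x y = InHalf s o x y × HasCodeFrom (suc o) σ x y

HasCode⇒HasCodeFrom : ∀ o {n} (σ : Vec Bool n) {x y} →
  (∀ i → InHalf (lookup σ i) (o ℕ.+ toℕ i) x y) → HasCodeFrom o σ x y
HasCode⇒HasCodeFrom o []      code = tt
HasCode⇒HasCodeFrom o (s ∷ σ) {x} {y} code =
  subst (λ k → InHalf s k x y) (ℕ.+-identityʳ o) (code zero) ,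
  HasCode⇒HasCodeFrom (suc o) σ
    (λ i → subst (λ k → InHalf (lookup σ i) k x y) (ℕ.+-suc o (toℕ i)) (code (suc i)))

module _ {x y : ℚ} where

  HasCodeFrom⇒Ones : ∀ o {n} (σ : Vec Bool n) → 0ℚ ℚ.< H o x y → 0ℚ ℚ.< ΔH o x →
                     HasCodeFrom (suc o) σ x y → Ones σ
  HasCodeFrom⇒Ones o []          H>0 Δ>0 _          = tt
  HasCodeFrom⇒Ones o (true ∷ σ)  H>0 Δ>0 (H′>0 , code) =
    HasCodeFrom⇒Ones (suc o) σ H′>0 (ΔH-pos-suc o x Δ>0) code
  HasCodeFrom⇒Ones o (false ∷ σ) H>0 Δ>0 (H′<0 , _)   = <-asym H′<0 (H-pos-suc o x y H>0 Δ>0)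

  HasCodeFrom⇒ZerosOnes : ∀ o {n} (σ : Vec Bool n) → H o x y ℚ.< 0ℚ →
                          HasCodeFrom (suc o) σ x y → ZerosOnes σ
  HasCodeFrom⇒ZerosOnes o []          H<0 _             = tt
  HasCodeFrom⇒ZerosOnes o (false ∷ σ) H<0 (H′<0 , code) = HasCodeFrom⇒ZerosOnes (suc o) σ H′<0 code
  HasCodeFrom⇒ZerosOnes o (true ∷ σ)  H<0 (H′>0 , code) =
    HasCodeFrom⇒Ones (suc o) σ H′>0 (ΔH-pos-suc o x (ΔH-pos-of-sign-change o x y H<0 H′>0)) code

  HasCodeFrom⇒OnesZerosOnes : ∀ o {n} (σ : Vec Bool n) → HasCodeFrom o σ x y → OnesZerosOnes σ
  HasCodeFrom⇒OnesZerosOnes o []          _           = tt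
  HasCodeFrom⇒OnesZerosOnes o (true ∷ σ)  (_ , code)   = HasCodeFrom⇒OnesZerosOnes (suc o) σ code
  HasCodeFrom⇒OnesZerosOnes o (false ∷ σ) (H<0 , code) = HasCodeFrom⇒ZerosOnes o σ H<0 code

InP⇒OnesZerosOnes : ∀ n (σ : Vec Bool n) → InP n σ → OnesZerosOnes σ
InP⇒OnesZerosOnes n σ (x , y , code) = HasCodeFrom⇒OnesZerosOnes 0 σ (HasCode⇒HasCodeFrom 0 σ code)

valleyDigit : ℕ → ℕ → ℕ → Bool
valleyDigit (suc a) b       zero    = true
valleyDigit (suc a) b       (suc i) = valleyDigit a b i
valleyDigit zero    (suc b) zero    = false
valleyDigit zero    (suc b) (suc i) = valleyDigit zero b i
valleyDigit zero    zero    i       = true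

valleyDigit≡true⇒ : ∀ a b i → valleyDigit a b i ≡ true → i < a ⊎ a ℕ.+ b ≤ i
valleyDigit≡true⇒ (suc a) b       zero    _ = inj₁ (s≤s z≤n)
valleyDigit≡true⇒ (suc a) b       (suc i) e with valleyDigit≡true⇒ a b i e
... | inj₁ i<a   = inj₁ (s≤s i<a)
... | inj₂ a+b≤i = inj₂ (s≤s a+b≤i)
valleyDigit≡true⇒ zero    (suc b) (suc i) e with valleyDigit≡true⇒ zero b i e
... | inj₂ b≤i = inj₂ (s≤s b≤i)
valleyDigit≡true⇒ zero    zero    i       _ = inj₂ z≤n

valleyDigit≡false⇒ : ∀ a b i → valleyDigit a b i ≡ false → a ≤ i × i < a ℕ.+ b
valleyDigit≡false⇒ (suc a) b       (suc i) e with valleyDigit≡false⇒ a b i e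
... | a≤i , i<a+b = s≤s a≤i , s≤s i<a+b
valleyDigit≡false⇒ zero    (suc b) zero    _ = z≤n , s≤s z≤n
valleyDigit≡false⇒ zero    (suc b) (suc i) e with valleyDigit≡false⇒ zero b i e
... | _ , i<b = z≤n , s≤s i<b

Ones⇒digits : ∀ {n} (σ : Vec Bool n) → Ones σ → ∀ i → lookup σ i ≡ valleyDigit 0 0 (toℕ i)
Ones⇒digits (true ∷ σ) ones zero    = refl
Ones⇒digits (true ∷ σ) ones (suc i) = Ones⇒digits σ ones i

ZerosOnes⇒digits : ∀ {n} (σ : Vec Bool n) → ZerosOnes σ →
                   ∃[ b ] ∀ i → lookup σ i ≡ valleyDigit 0 b (toℕ i)
ZerosOnes⇒digits []          _     = 0 , λ ()
ZerosOnes⇒digits (true ∷ σ)  ones  = 0 , Ones⇒digits (true ∷ σ) ones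
ZerosOnes⇒digits (false ∷ σ) zeros with ZerosOnes⇒digits σ zeros
... | b , digits = suc b , λ { zero → refl ; (suc i) → digits i }

OnesZerosOnes⇒digits : ∀ {n} (σ : Vec Bool n) → OnesZerosOnes σ →
                       ∃[ a ] ∃[ b ] ∀ i → lookup σ i ≡ valleyDigit a b (toℕ i)
OnesZerosOnes⇒digits []          _ = 0 , 0 , λ ()
OnesZerosOnes⇒digits (true ∷ σ)  valley with OnesZerosOnes⇒digits σ valley
... | a , b , digits = suc a , b , λ { zero → refl ; (suc i) → digits i }
OnesZerosOnes⇒digits (false ∷ σ) valley with ZerosOnes⇒digits σ valley
... | b , digits = 0 , suc b , λ { zero → refl ; (suc i) → digits i }

0<p∧0<q⇒0<p*q : ∀ {p q} → 0ℚ ℚ.< p → 0ℚ ℚ.< q → 0ℚ ℚ.< p * q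
0<p∧0<q⇒0<p*q {p} {q} p>0 q>0 = positive⁻¹ (p * q) {{pos*pos⇒pos p {{positive p>0}} q {{positive q>0}}}}

p<0∧q<0⇒0<p*q : ∀ {p q} → p ℚ.< 0ℚ → q ℚ.< 0ℚ → 0ℚ ℚ.< p * q
p<0∧q<0⇒0<p*q {p} {q} p<0 q<0 = positive⁻¹ (p * q) {{neg*neg⇒pos p {{negative p<0}} q {{negative q<0}}}}

0<p∧q<0⇒p*q<0 : ∀ {p q} → 0ℚ ℚ.< p → q ℚ.< 0ℚ → p * q ℚ.< 0ℚ
0<p∧q<0⇒p*q<0 {p} {q} p>0 q<0 = negative⁻¹ (p * q) {{pos*neg⇒neg p {{positive p>0}} q {{negative q<0}}}}

H-at-tangent-intersection : ∀ i u v → H i (u + v) (u * v) ≡ (ℕ→ℚ i - u) * (ℕ→ℚ i - v)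
H-at-tangent-intersection i u v = identity (ℕ→ℚ i) u v
  where
  identity : ∀ c u v → u * v - c * (u + v) + c * c ≡ (c - u) * (c - v)
  identity = solve-∀ ℚ-ring

root : ℕ → ℚ
root c = ℕ→ℚ c - ½

root-below : ∀ {c i} → c ≤ i → 0ℚ ℚ.< ℕ→ℚ i - root c
root-below {c} c≤i with ℕ.m≤n⇒∃[o]m+o≡n c≤i
... | d , refl = subst (0ℚ ℚ.<_) (sym shift) (+-mono-≤-< (ℕ→ℚ-nonNeg d) (positive⁻¹ ½))
  where
  identity : ∀ c d h → c + d - (c - h) ≡ d + h
  identity = solve-∀ ℚ-ring
  shift : ℕ→ℚ (c ℕ.+ d) - root c ≡ ℕ→ℚ d + ½
  shift = trans (cong (_- root c) (ℕ→ℚ-+ c d)) (identity (ℕ→ℚ c) (ℕ→ℚ d) ½)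

root-above : ∀ {c i} → i < c → ℕ→ℚ i - root c ℚ.< 0ℚ
root-above {c} {i} i<c with ℕ.m≤n⇒∃[o]m+o≡n i<c
... | d , refl = subst (ℚ._< 0ℚ) (sym shift) (neg-antimono-< (+-mono-≤-< (ℕ→ℚ-nonNeg d) (positive⁻¹ ½)))
  where
  identity : ∀ i d → i - (1ℚ + i + d - ½) ≡ - (d + ½)
  identity = solve-∀ ℚ-ring
  shift : ℕ→ℚ i - root (suc i ℕ.+ d) ≡ - (ℕ→ℚ d + ½)
  shift = trans (cong (λ q → ℕ→ℚ i - (q - ½)) (trans (ℕ→ℚ-+ (suc i) d) (cong (_+ ℕ→ℚ d) (ℕ→ℚ-suc i))))
                (identity (ℕ→ℚ i) (ℕ→ℚ d))

InHalf-valleyDigit : ∀ a b i → let u = root a; v = root (a ℕ.+ b) in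
                     InHalf (valleyDigit a b i) i (u + v) (u * v)
InHalf-valleyDigit a b i with valleyDigit a b i in digit
... | true  = subst (0ℚ ℚ.<_) (sym (H-at-tangent-intersection i _ _))
                (sameSign (valleyDigit≡true⇒ a b i digit))
  where
  sameSign : i < a ⊎ a ℕ.+ b ≤ i → 0ℚ ℚ.< (ℕ→ℚ i - root a) * (ℕ→ℚ i - root (a ℕ.+ b))
  sameSign (inj₁ i<a)   = p<0∧q<0⇒0<p*q (root-above i<a) (root-above (ℕ.<-≤-trans i<a (ℕ.m≤m+n a b)))
  sameSign (inj₂ a+b≤i) = 0<p∧0<q⇒0<p*q (root-below (ℕ.≤-trans (ℕ.m≤m+n a b) a+b≤i)) (root-below a+b≤i)
... | false with valleyDigit≡false⇒ a b i digit
...   | a≤i , i<a+b = subst (ℚ._< 0ℚ) (sym (H-at-tangent-intersection i _ _))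
                        (0<p∧q<0⇒p*q<0 (root-below a≤i) (root-above i<a+b))

OnesZerosOnes⇒InP : ∀ n (σ : Vec Bool n) → OnesZerosOnes σ → InP n σ
OnesZerosOnes⇒InP n σ valley with OnesZerosOnes⇒digits σ valley
... | a , b , digits = root a + root (a ℕ.+ b) , root a * root (a ℕ.+ b) , λ i →
  subst (λ s → InHalf s (toℕ i) _ _) (sym (digits i)) (InHalf-valleyDigit a b (toℕ i))

InP⇔OnesZerosOnes : ∀ n (σ : Vec Bool n) → InP n σ ⇔ OnesZerosOnes σ
InP⇔OnesZerosOnes n σ = mk⇔ (InP⇒OnesZerosOnes n σ) (OnesZerosOnes⇒InP n σ)

Ones-∷ʳ-true : ∀ {n} (w : Vec Bool n) → Ones (w ∷ʳ true) ⇔ Ones w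
Ones-∷ʳ-true []          = ⇔.refl
Ones-∷ʳ-true (true ∷ w)  = Ones-∷ʳ-true w
Ones-∷ʳ-true (false ∷ w) = ⇔.refl

ZerosOnes-∷ʳ-true : ∀ {n} (w : Vec Bool n) → ZerosOnes (w ∷ʳ true) ⇔ ZerosOnes w
ZerosOnes-∷ʳ-true []          = ⇔.refl
ZerosOnes-∷ʳ-true (false ∷ w) = ZerosOnes-∷ʳ-true w
ZerosOnes-∷ʳ-true (true ∷ w)  = Ones-∷ʳ-true w

OnesZerosOnes-∷ʳ-true : ∀ {n} (w : Vec Bool n) → OnesZerosOnes (w ∷ʳ true) ⇔ OnesZerosOnes w
OnesZerosOnes-∷ʳ-true []          = ⇔.refl
OnesZerosOnes-∷ʳ-true (true ∷ w)  = OnesZerosOnes-∷ʳ-true w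
OnesZerosOnes-∷ʳ-true (false ∷ w) = ZerosOnes-∷ʳ-true w

ZerosOnes-replicate-false : ∀ n → ZerosOnes (replicate n false)
ZerosOnes-replicate-false zero    = tt
ZerosOnes-replicate-false (suc n) = ZerosOnes-replicate-false n

OnesZerosOnes-block : ∀ n k → OnesZerosOnes (block n k)
OnesZerosOnes-block zero    k       = tt
OnesZerosOnes-block (suc n) zero    = ZerosOnes-replicate-false n
OnesZerosOnes-block (suc n) (suc k) = OnesZerosOnes-block n k

last-replicate-false : ∀ n → last (replicate (suc n) false) ≡ false
last-replicate-false zero    = refl
last-replicate-false (suc n) = last-replicate-false n

last-block : ∀ m k → k < suc m → last (block (suc m) k) ≡ false
last-block m       zero    _         = last-replicate-false m
last-block (suc m) (suc k) (s≤s k<m) = last-block m k k<m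

Ones⇒last≡true : ∀ {n} (σ : Vec Bool n) → Ones σ → last (true ∷ σ) ≡ true
Ones⇒last≡true []         _    = refl
Ones⇒last≡true (true ∷ σ) ones = Ones⇒last≡true σ ones

ZerosOnes∧last≡false⇒replicate : ∀ {n} (σ : Vec Bool n) → ZerosOnes σ → last (false ∷ σ) ≡ false →
                                 σ ≡ replicate n false
ZerosOnes∧last≡false⇒replicate []          _     _    = refl
ZerosOnes∧last≡false⇒replicate (false ∷ σ) zeros ends0 =
  cong (false ∷_) (ZerosOnes∧last≡false⇒replicate σ zeros ends0)
ZerosOnes∧last≡false⇒replicate (true ∷ σ)  ones  ends0 with trans (sym (Ones⇒last≡true σ ones)) ends0
... | ()

OnesZerosOnes∧last≡false⇒block : ∀ m (σ : Vec Bool (suc m)) → OnesZerosOnes σ → last σ ≡ false →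
                                 ∃[ k ] k < suc m × σ ≡ block (suc m) k
OnesZerosOnes∧last≡false⇒block m       (false ∷ σ) zeros ends0 =
  0 , s≤s z≤n , cong (false ∷_) (ZerosOnes∧last≡false⇒replicate σ zeros ends0)
OnesZerosOnes∧last≡false⇒block zero    (true ∷ []) _ ()
OnesZerosOnes∧last≡false⇒block (suc m) (true ∷ σ)  valley ends0
  with OnesZerosOnes∧last≡false⇒block m σ valley ends0
... | k , k<m , refl = suc k , s≤s k<m , refl

OnesZerosOnes∧last≡false⇔block : ∀ m (σ : Vec Bool (suc m)) →
  (OnesZerosOnes σ × last σ ≡ false) ⇔ (∃[ k ] k < suc m × σ ≡ block (suc m) k)
OnesZerosOnes∧last≡false⇔block m σ = mk⇔
  (λ (valley , ends0) → OnesZerosOnes∧last≡false⇒block m σ valley ends0)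
  (λ { (k , k<m , refl) → OnesZerosOnes-block (suc m) k , last-block m k k<m })

proposition18 : (m : ℕ) →
    -- regions of the new arrangement in H_{n-1}^- are exactly those with codes 1^k 0^(n-k), k < n
    ((σ : Vec Bool (suc m)) → (InP (suc m) σ × last σ ≡ false) ⇔ Σ ℕ (λ k → k < suc m × σ ≡ block (suc m) k))
    -- regions in H_{n-1}^+ correspond to old regions w, with code w1
    × ((w : Vec Bool m) → InP (suc m) (w ∷ʳ true) ⇔ InP m w)
    -- P_n = { w1 : w ∈ P_{n-1} } ∪ { 1^k 0^(n-k) : 0 ≤ k ≤ n-1 }
    × ((σ : Vec Bool (suc m)) → InP (suc m) σ ⇔
         (Σ (Vec Bool m) (λ w → InP m w × σ ≡ w ∷ʳ true) ⊎ Σ ℕ (λ k → k < suc m × σ ≡ block (suc m) k)))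
proposition18 m = newRegions , oldRegions , λ σ → mk⇔ (split σ) join
  where
  Block : Vec Bool (suc m) → Set
  Block σ = ∃[ k ] k < suc m × σ ≡ block (suc m) k

  newRegions : ∀ σ → (InP (suc m) σ × last σ ≡ false) ⇔ Block σ
  newRegions σ = ⇔.trans (InP⇔OnesZerosOnes (suc m) σ ×-⇔ ⇔.refl) (OnesZerosOnes∧last≡false⇔block m σ)

  oldRegions : ∀ w → InP (suc m) (w ∷ʳ true) ⇔ InP m w
  oldRegions w = ⇔.trans (InP⇔OnesZerosOnes (suc m) (w ∷ʳ true))
                         (⇔.trans (OnesZerosOnes-∷ʳ-true w) (⇔.sym (InP⇔OnesZerosOnes m w)))

  split : ∀ σ → InP (suc m) σ → (∃[ w ] InP m w × σ ≡ w ∷ʳ true) ⊎ Block σ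
  split σ region with initLast σ
  ... | w , true  , refl = inj₁ (w , Equivalence.to (oldRegions w) region , refl)
  ... | w , false , refl = inj₂ (Equivalence.to (newRegions _) (region , last-∷ʳ false w))

  join : ∀ {σ} → (∃[ w ] InP m w × σ ≡ w ∷ʳ true) ⊎ Block σ → InP (suc m) σ
  join (inj₁ (w , region , refl)) = Equivalence.from (oldRegions w) region
  join (inj₂ block)               = proj₁ (Equivalence.from (newRegions _) block)
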